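{- For any formula $\phi$ of $\mathcal L$ and any enumeration $\{\xi_u\}_{u\in U}$ of deterministic partial recursive functions, the following are equivalent: (1) $\{\xi_u\}_{u\in U}\vDash\phi$; (2) $w\Vdash\phi$ for every world $w$ of every deterministic Kripke model; (3) $\vdash_{\Re_d}\phi$.
   Context: The language $\mathcal L$: formulas built from propositional variables and $\bot$ using $\rightarrow$ and a binary modality $\rhd$; $\wedge,\vee,\neg,\top$ defined as usual. The logic $\Re$: classical propositional logic in $\mathcal L$ plus axioms A1: $\phi\rhd\psi\rightarrow(\chi\rhd\psi\rightarrow(\phi\vee\chi)\rhd\psi)$, A2: $\bot\rhd\phi$, A3: $\phi\rhd\top$, with rules Modus Ponens and M: from $\phi_1\rightarrow\phi_2$ and $\psi_1\rightarrow\psi_2$ infer $\phi_2\rhd\psi_1\rightarrow\phi_1\rhd\psi_2$. The logic $\Re_d$ is $\Re$ plus axiom A4: $\phi\rhd\psi\rightarrow(\phi\rhd\chi\rightarrow\phi\rhd(\psi\wedge\chi))$. Kripke model: a triple $\langle W,\rightarrow,\Vdash\rangle$ with $W$ a finite set of worlds, $\rightarrow$ a ternary relation written $u\rightarrow_w v$, $\Vdash$ a relation between worlds and propositional variables, extended by: $w\nVdash\bot$; $w\Vdash\phi\rightarrow\psi$ iff $w\nVdash\phi$ or $w\Vdash\psi$; $w\Vdash\phi\rhd\psi$ iff for all $u,v$ with $u\rightarrow_w v$ and $u\Vdash\phi$ there is $v'$ with $u\rightarrow_w v'$ and $v'\Vdash\psi$. It is deterministic if for all $w,u\in W$ there is at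 most one $v$ with $u\rightarrow_w v$. Semantics: $U$ is a universe (e.g. all words over an alphabet) and $\{\xi_u\}_{u\in U}$ is an enumeration, indexed by elements of $U$, of all deterministic partial recursive functions from $U$ to $U$, viewed set-valued: $\xi_w(x)$ is $\varnothing$ if $\xi_w$ diverges on $x$ and the singleton of its value otherwise. The enumeration is assumed to satisfy the following form of Kleene's recursion theorem: for any total recursive $f_1,\dots,f_n:U^n\to U$ there are $u_1,\dots,u_n\in U$ with $\xi_{u_i}\equiv\xi_{f_i(u_1,\dots,u_n)}$ for all $i$. A valuation $*$ maps propositional variables to subsets of $U$, extended by $\bot^*=\varnothing$, $(\phi\rightarrow\psi)^*=(U\setminus\phi^*)\cup\psi^*$, $(\phi\rhd\psi)^*=\{w\in U\mid\forall u\in\phi^*\ (\xi_w(u)\neq\varnothing\rightarrow\xi_w(u)\cap\psi^*\neq\varnothing)\}$. $\{\xi_u\}_{u\in U}\vDash\phi$ means $\phi^*=U$ for every valuation $*$. -}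

module Defs where

open import Level using (0ℓ)
open import Data.Nat using (ℕ; zero; suc; _<_)
open import Data.Fin using (Fin)
open import Data.Vec using (Vec; []; _∷_; lookup)
open import Data.Product using (Σ; ∃; _×_; _,_)
open import Data.Sum using (_⊎_)
open import Data.Empty using (⊥)
open import Relation.Nullary using (¬_)
open import Relation.Binary.PropositionalEquality using (_≡_)
open import Function.Bundles using (_⇔_)

infixr 6 _⇒_
infix  7 _▷_

data Fm : Set where
  var : ℕ → Fm
  ⊥'  : Fm
  _⇒_ : Fm → Fm → Fm
  _▷_ : Fm → Fm → Fm

¬' : Fm → Fm
¬' φ = φ ⇒ ⊥'

⊤' : Fm
⊤' = ¬' ⊥'

_∨'_ : Fm → Fm → Fm
φ ∨' ψ = ¬' φ ⇒ ψ

_∧'_ : Fm → Fm → Fm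
φ ∧' ψ = ¬' (φ ⇒ ¬' ψ)

-- The logic R_d : classical propositional logic (Hilbert axioms K, S,
-- double negation elimination; complete for the {⇒,⊥} fragment),
-- A1–A4, rules MP and M.

data ⊢Rd : Fm → Set where
  axK  : ∀ φ ψ → ⊢Rd (φ ⇒ ψ ⇒ φ)
  axS  : ∀ φ ψ χ → ⊢Rd ((φ ⇒ ψ ⇒ χ) ⇒ (φ ⇒ ψ) ⇒ φ ⇒ χ)
  axDN : ∀ φ → ⊢Rd (¬' (¬' φ) ⇒ φ)
  axA1 : ∀ φ ψ χ → ⊢Rd (φ ▷ ψ ⇒ χ ▷ ψ ⇒ (φ ∨' χ) ▷ ψ)
  axA2 : ∀ φ → ⊢Rd (⊥' ▷ φ)
  axA3 : ∀ φ → ⊢Rd (φ ▷ ⊤')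
  axA4 : ∀ φ ψ χ → ⊢Rd (φ ▷ ψ ⇒ φ ▷ χ ⇒ φ ▷ (ψ ∧' χ))
  mp   : ∀ {φ ψ} → ⊢Rd (φ ⇒ ψ) → ⊢Rd φ → ⊢Rd ψ
  ruleM : ∀ {φ₁ φ₂ ψ₁ ψ₂} → ⊢Rd (φ₁ ⇒ φ₂) → ⊢Rd (ψ₁ ⇒ ψ₂) →
          ⊢Rd (φ₂ ▷ ψ₁ ⇒ φ₁ ▷ ψ₂)

-- Kripke models (finite set of worlds Fin n, ternary relation
-- R w u v  meaning  u →_w v, forcing of variables V)

record KModel : Set₁ where
  field
    size : ℕ
    R    : Fin size → Fin size → Fin size → Set
    V    : Fin size → ℕ → Set

module _ (M : KModel) where
  open KModel M

  _⊩_ : Fin size → Fm → Set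
  w ⊩ var p   = V w p
  w ⊩ ⊥'      = ⊥
  w ⊩ (φ ⇒ ψ) = ¬ (w ⊩ φ) ⊎ w ⊩ ψ
  w ⊩ (φ ▷ ψ) = ∀ u v → R w u v → u ⊩ φ → ∃ λ v' → R w u v' × v' ⊩ ψ

Deterministic : KModel → Set
Deterministic M = ∀ w u v v' → R w u v → R w u v' → v ≡ v'
  where open KModel M

KValid : Fm → Set₁
KValid φ = (M : KModel) → Deterministic M → ∀ w → _⊩_ M w φ

-- Partial recursive functions on U = ℕ (μ-recursive codes with
-- big-step evaluation relation)

data Code : ℕ → Set where
  zer  : ∀ {k} → Code k
  sc   : Code 1
  proj : ∀ {k} → Fin k → Code k
  comp : ∀ {m k} → Code m → Vec (Code k) m → Code k
  prec : ∀ {k} → Code k → Code (suc (suc k)) → Code (suc k)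
  mu   : ∀ {k} → Code (suc k) → Code k

mutual
  data Eval : ∀ {k} → Code k → Vec ℕ k → ℕ → Set where
    ev-zer  : ∀ {k} {xs : Vec ℕ k} → Eval zer xs 0
    ev-sc   : ∀ {x} → Eval sc (x ∷ []) (suc x)
    ev-proj : ∀ {k} {i : Fin k} {xs} → Eval (proj i) xs (lookup xs i)
    ev-comp : ∀ {m k} {f : Code m} {gs : Vec (Code k) m} {xs ys z} →
              EvalAll gs xs ys → Eval f ys z → Eval (comp f gs) xs z
    ev-prec0 : ∀ {k} {f : Code k} {g} {xs z} →
              Eval f xs z → Eval (prec f g) (0 ∷ xs) z
    ev-precS : ∀ {k} {f : Code k} {g} {n xs y z} →
              Eval (prec f g) (n ∷ xs) y → Eval g (n ∷ y ∷ xs) z →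
              Eval (prec f g) (suc n ∷ xs) z
    ev-mu   : ∀ {k} {f : Code (suc k)} {xs n} →
              Eval f (n ∷ xs) 0 →
              (∀ m → m < n → ∃ λ j → Eval f (m ∷ xs) (suc j)) →
              Eval (mu f) xs n

  data EvalAll {k} : ∀ {m} → Vec (Code k) m → Vec ℕ k → Vec ℕ m → Set where
    []  : ∀ {xs} → EvalAll [] xs []
    _∷_ : ∀ {m} {g} {gs : Vec (Code k) m} {xs y ys} →
          Eval g xs y → EvalAll gs xs ys → EvalAll (g ∷ gs) xs (y ∷ ys)

PFun : Set₁
PFun = ℕ → ℕ → Set

_≈F_ : PFun → PFun → Set
f ≈F g = ∀ x y → (f x y ⇔ g x y)

⟦_⟧₁ : Code 1 → PFun
⟦ c ⟧₁ x y = Eval c (x ∷ []) y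

TotalRecursive : ∀ {n} → (Vec ℕ n → ℕ) → Set
TotalRecursive {n} f = Σ (Code n) λ c → ∀ xs → Eval c xs (f xs)

record Enumeration (ξ : ℕ → PFun) : Set where
  field
    onlyRecursive : ∀ w → Σ (Code 1) λ c → ξ w ≈F ⟦ c ⟧₁
    allRecursive  : ∀ (c : Code 1) → Σ ℕ λ w → ξ w ≈F ⟦ c ⟧₁
    recursionThm  : ∀ n (f : Fin n → Vec ℕ n → ℕ) →
                    (∀ i → TotalRecursive (f i)) →
                    Σ (Vec ℕ n) λ us →
                      ∀ i → ξ (lookup us i) ≈F ξ (f i us)

Valuation : Set₁
Valuation = ℕ → ℕ → Set     -- variable ↦ subset of U = ℕ

_∈⟦_⟧_/_ : ℕ → Fm → (ℕ → PFun) → Valuation → Set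
w ∈⟦ var p ⟧ ξ / * = * p w
w ∈⟦ ⊥' ⟧ ξ / *    = ⊥
w ∈⟦ φ ⇒ ψ ⟧ ξ / * = ¬ (w ∈⟦ φ ⟧ ξ / *) ⊎ w ∈⟦ ψ ⟧ ξ / *
w ∈⟦ φ ▷ ψ ⟧ ξ / * = ∀ u → u ∈⟦ φ ⟧ ξ / * →
                     (∃ λ v → ξ w u v) →
                     ∃ λ v → ξ w u v × v ∈⟦ ψ ⟧ ξ / *

_⊨_ : (ℕ → PFun) → Fm → Set₁
ξ ⊨ φ = ∀ (* : Valuation) w → w ∈⟦ φ ⟧ ξ / *

-- Soundness holds in every deterministic frame, which covers both Kripke models and
-- the arithmetic reading, where u →_w v means ξ_w(u) = v.
--
-- For completeness, the worlds of a finite canonical model are consistent Boolean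
-- assignments to the atoms of φ (its variables and ▷-subformulas); a false α ▷ β is
-- refuted by a pair of successors, the first satisfying α and the second refuting β,
-- whose existence is where A1–A4 and rule M are used.
--
-- Conversely, arithmetic validity implies Kripke validity. Cutting a finite
-- deterministic model into levels, where level k + 1 only sees level k, preserves
-- formulas of modal depth at most k. This unravelled model maps into {ξ_u} as a
-- bounded morphism: a world at level k + 1 goes to an index of the finite partial
-- function sending the images of its u's to those of its v's. The recursion
-- theorem provides arbitrarily large indices of any function, so these indices can
-- be chosen distinct.

module Submission where

open import Defs
open import Level using (0ℓ)
open import Axiom.ExcludedMiddle using (ExcludedMiddle)
open import Data.Bool using (Bool; true; false; not; _∨_; _∧_; T; if_then_else_)
open import Data.Bool.Properties using (T-≡)
open import Data.Empty using (⊥; ⊥-elim)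
open import Data.List using (List; []; _∷_; [_]; _++_; map; length; lookup; allFin; filter; upTo; cartesianProduct)
import Data.List.Membership.DecPropositional as DecMembership
open import Data.List.Membership.Propositional using (_∈_)
open import Data.List.Membership.Propositional.Properties
  using (∈-map⁺; ∈-map⁻; ∈-++⁻; ∈-allFin; ∈-lookup; ∈-filter⁺; ∈-filter⁻; ∈-upTo⁺; ∈-cartesianProduct⁺)
open import Data.List.Relation.Binary.Subset.Propositional using (_⊆_)
open import Data.List.Relation.Binary.Subset.Propositional.Properties
  using (⊆-refl; ⊆-trans; xs⊆xs++ys; xs⊆ys++xs; xs⊆x∷xs; ++⁺; ++⁺ˡ)
open import Data.List.Relation.Unary.Any using (here; there)
import Data.List.Relation.Unary.Any as Any
open import Data.List.Relation.Unary.Any.Properties using (lookup-index)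
open import Data.Nat using (ℕ; zero; suc; _≤_; _<_; _≤′_; ≤′-refl; ≤′-step; _⊔_; _^_; _*_; _∸_; pred; s≤s)
import Data.Nat.Properties as ℕₚ
open import Data.Nat.Properties
  using (≤-refl; ≤-trans; <-irrefl; <-≤-trans; <-cmp; <⇒≢; ≮⇒≥; ≤⇒≤′; n≤1+n; m≤m⊔n; m≤n⊔m; pred[m∸n]≡m∸[1+n])
open import Data.Fin using (Fin; zero; suc; combine; remQuot; finToFun; funToFin)
open import Data.Fin.Patterns using (0F; 1F; 2F; 3F)
open import Data.Fin.Properties using (remQuot-combine; finToFun-funToFin; suc-injective; 2↔Bool)
open import Data.Vec using (Vec; []; _∷_)
import Data.Vec as Vec
import Data.Nat as ℕ
open import Data.Product using (Σ; ∃; ∃₂; _×_; _,_; proj₁; proj₂; uncurry; map₂)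
import Data.Product as Product
open import Data.Sum using (_⊎_; inj₁; inj₂)
import Data.Sum as Sum
open import Data.Unit using (tt)
open import Function using (_∘_; case_of_)
open import Function.Bundles using (_⇔_; mk⇔; Equivalence; Inverse)
import Function.Properties.Equivalence as ⇔
open import Relation.Binary.Definitions using (DecidableEquality; tri<; tri≈; tri>)
open import Relation.Binary.PropositionalEquality
  using (_≡_; _≢_; refl; sym; trans; cong; cong₂; subst; module ≡-Reasoning)
open import Relation.Nullary using (¬_; yes; no; contradiction)
open import Relation.Nullary.Decidable using (map′; _×-dec_; T?)
open import Relation.Unary using (Decidable)

var-injective : ∀ {p q} → var p ≡ var q → p ≡ q
var-injective refl = refl

⇒-injective : ∀ {a b c d} → a ⇒ b ≡ c ⇒ d → a ≡ c × b ≡ d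
⇒-injective refl = refl , refl

▷-injective : ∀ {a b c d} → a ▷ b ≡ c ▷ d → a ≡ c × b ≡ d
▷-injective refl = refl , refl

infix 4 _≟ᶠ_
_≟ᶠ_ : DecidableEquality Fm
var p   ≟ᶠ var q   = map′ (cong var) var-injective (p ℕ.≟ q)
⊥'      ≟ᶠ ⊥'      = yes refl
(a ⇒ b) ≟ᶠ (c ⇒ d) = map′ (uncurry (cong₂ _⇒_)) ⇒-injective (a ≟ᶠ c ×-dec b ≟ᶠ d)
(a ▷ b) ≟ᶠ (c ▷ d) = map′ (uncurry (cong₂ _▷_)) ▷-injective (a ≟ᶠ c ×-dec b ≟ᶠ d)
var _   ≟ᶠ ⊥'      = no λ ()
var _   ≟ᶠ (_ ⇒ _) = no λ ()
var _   ≟ᶠ (_ ▷ _) = no λ ()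
⊥'      ≟ᶠ var _   = no λ ()
⊥'      ≟ᶠ (_ ⇒ _) = no λ ()
⊥'      ≟ᶠ (_ ▷ _) = no λ ()
(_ ⇒ _) ≟ᶠ var _   = no λ ()
(_ ⇒ _) ≟ᶠ ⊥'      = no λ ()
(_ ⇒ _) ≟ᶠ (_ ▷ _) = no λ ()
(_ ▷ _) ≟ᶠ var _   = no λ ()
(_ ▷ _) ≟ᶠ ⊥'      = no λ ()
(_ ▷ _) ≟ᶠ (_ ⇒ _) = no λ ()

depth : Fm → ℕ
depth (var _) = 0
depth ⊥'      = 0
depth (a ⇒ b) = depth a ⊔ depth b
depth (a ▷ b) = suc (depth a ⊔ depth b)

atoms : Fm → List Fm
atoms (var p) = [ var p ]
atoms ⊥'      = []
atoms (a ⇒ b) = atoms a ++ atoms b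
atoms (a ▷ b) = [ a ▷ b ]

closure : Fm → List Fm
closure (var p) = [ var p ]
closure ⊥'      = []
closure (a ⇒ b) = closure a ++ closure b
closure (a ▷ b) = a ▷ b ∷ closure a ++ closure b

atoms⊆closure : ∀ ψ → atoms ψ ⊆ closure ψ
atoms⊆closure (var p) = ⊆-refl
atoms⊆closure ⊥'      = ⊆-refl
atoms⊆closure (a ⇒ b) = ++⁺ (atoms⊆closure a) (atoms⊆closure b)
atoms⊆closure (a ▷ b) (here refl) = here refl

∈-closure⇒⊆ : ∀ {χ} ψ → χ ∈ closure ψ → closure χ ⊆ closure ψ
∈-closure⇒⊆ (var p) (here refl) = ⊆-refl
∈-closure⇒⊆ (a ⇒ b) m with ∈-++⁻ (closure a) m
... | inj₁ m′ = ⊆-trans (∈-closure⇒⊆ a m′) (xs⊆xs++ys _ _)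
... | inj₂ m′ = ⊆-trans (∈-closure⇒⊆ b m′) (xs⊆ys++xs _ _)
∈-closure⇒⊆ (a ▷ b) (here refl) = ⊆-refl
∈-closure⇒⊆ (a ▷ b) (there m) with ∈-++⁻ (closure a) m
... | inj₁ m′ = ⊆-trans (∈-closure⇒⊆ a m′) (there ∘ xs⊆xs++ys _ _)
... | inj₂ m′ = ⊆-trans (∈-closure⇒⊆ b m′) (there ∘ xs⊆ys++xs _ _)

⋀ : List Fm → Fm
⋀ []      = ⊤'
⋀ (a ∷ L) = a ∧' ⋀ L

⋁ : List Fm → Fm
⋁ []      = ⊥'
⋁ (a ∷ L) = a ∨' ⋁ L

ev : (Fm → Bool) → Fm → Bool
ev t (var p) = t (var p)
ev t ⊥'      = false
ev t (a ⇒ b) = not (ev t a) ∨ ev t b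
ev t (a ▷ b) = t (a ▷ b)

infix 4 _⊨ᵇ_
_⊨ᵇ_ : (Fm → Bool) → Fm → Set
t ⊨ᵇ ψ = T (ev t ψ)

closure-atom : ∀ {x} ψ → x ∈ closure ψ → ∀ t → ev t x ≡ t x
closure-atom (var p) (here refl) t = refl
closure-atom (a ⇒ b) m t with ∈-++⁻ (closure a) m
... | inj₁ m′ = closure-atom a m′ t
... | inj₂ m′ = closure-atom b m′ t
closure-atom (a ▷ b) (here refl) t = refl
closure-atom (a ▷ b) (there m) t with ∈-++⁻ (closure a) m
... | inj₁ m′ = closure-atom a m′ t
... | inj₂ m′ = closure-atom b m′ t

⊨ᵇ-⇒⁺ : ∀ {t} a b → (t ⊨ᵇ a → t ⊨ᵇ b) → t ⊨ᵇ a ⇒ b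
⊨ᵇ-⇒⁺ {t} a b f with ev t a
... | false = tt
... | true  = f tt

⊨ᵇ-⇒⁻ : ∀ {t} a b → t ⊨ᵇ a ⇒ b → t ⊨ᵇ a → t ⊨ᵇ b
⊨ᵇ-⇒⁻ {t} a b h ta with ev t a
... | true  = h
... | false = ⊥-elim ta

⊨ᵇ-∧⁺ : ∀ {t} a b → t ⊨ᵇ a → t ⊨ᵇ b → t ⊨ᵇ a ∧' b
⊨ᵇ-∧⁺ a b ta tb = ⊨ᵇ-⇒⁺ (a ⇒ ¬' b) ⊥' λ h → ⊨ᵇ-⇒⁻ b ⊥' (⊨ᵇ-⇒⁻ a (¬' b) h ta) tb

⊨ᵇ-∧⁻ : ∀ {t} a b → t ⊨ᵇ a ∧' b → t ⊨ᵇ a × t ⊨ᵇ b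
⊨ᵇ-∧⁻ {t} a b h with ev t a | ev t b
... | true  | true  = tt , tt
... | true  | false = ⊥-elim h
... | false | _     = ⊥-elim h

module _ {I : Set} (f : I → Fm) where

  ⊨ᵇ-⋀⁺ : ∀ {t} is → (∀ {i} → i ∈ is → t ⊨ᵇ f i) → t ⊨ᵇ ⋀ (map f is)
  ⊨ᵇ-⋀⁺ []       _ = tt
  ⊨ᵇ-⋀⁺ (i ∷ is) h = ⊨ᵇ-∧⁺ (f i) (⋀ (map f is)) (h (here refl)) (⊨ᵇ-⋀⁺ is (h ∘ there))

  ⊨ᵇ-⋀⁻ : ∀ {t i} is → t ⊨ᵇ ⋀ (map f is) → i ∈ is → t ⊨ᵇ f i
  ⊨ᵇ-⋀⁻ (j ∷ is) h (here refl) = proj₁ (⊨ᵇ-∧⁻ (f j) (⋀ (map f is)) h)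
  ⊨ᵇ-⋀⁻ (j ∷ is) h (there m)   = ⊨ᵇ-⋀⁻ is (proj₂ (⊨ᵇ-∧⁻ (f j) (⋀ (map f is)) h)) m

  ⊨ᵇ-⋁⁺ : ∀ {t i} is → i ∈ is → t ⊨ᵇ f i → t ⊨ᵇ ⋁ (map f is)
  ⊨ᵇ-⋁⁺ (j ∷ is) (here refl) ti = ⊨ᵇ-⇒⁺ (¬' (f j)) (⋁ (map f is)) λ t¬fj → ⊥-elim (⊨ᵇ-⇒⁻ (f j) ⊥' t¬fj ti)
  ⊨ᵇ-⋁⁺ (j ∷ is) (there m)   ti = ⊨ᵇ-⇒⁺ (¬' (f j)) (⋁ (map f is)) λ _ → ⊨ᵇ-⋁⁺ is m ti

Agree : List Fm → (Fm → Bool) → (Fm → Bool) → Set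
Agree X s t = ∀ {x} → x ∈ X → s x ≡ t x

ev-agree : ∀ {X s t} ψ → atoms ψ ⊆ X → Agree X s t → ev s ψ ≡ ev t ψ
ev-agree (var p) sub agree = agree (sub (here refl))
ev-agree ⊥'      sub agree = refl
ev-agree (a ⇒ b) sub agree =
  cong₂ (λ x y → not x ∨ y) (ev-agree a (sub ∘ xs⊆xs++ys _ _) agree) (ev-agree b (sub ∘ xs⊆ys++xs _ _) agree)
ev-agree (a ▷ b) sub agree = agree (sub (here refl))

⊨ᵇ-agree : ∀ {X s t} ψ → atoms ψ ⊆ X → Agree X s t → s ⊨ᵇ ψ → t ⊨ᵇ ψ
⊨ᵇ-agree ψ sub agree = subst T (ev-agree ψ sub agree)

module _ {X : List Fm} where

  atoms-⇒ : ∀ a b → atoms a ⊆ X → atoms b ⊆ X → atoms (a ⇒ b) ⊆ X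
  atoms-⇒ a b sa sb m = Sum.[ sa , sb ] (∈-++⁻ (atoms a) m)

  atoms-¬ : ∀ a → atoms a ⊆ X → atoms (¬' a) ⊆ X
  atoms-¬ a sa = atoms-⇒ a ⊥' sa λ ()

  atoms-∧ : ∀ a b → atoms a ⊆ X → atoms b ⊆ X → atoms (a ∧' b) ⊆ X
  atoms-∧ a b sa sb = atoms-¬ (a ⇒ ¬' b) (atoms-⇒ a (¬' b) sa (atoms-¬ b sb))

  module _ {I : Set} (f : I → Fm) where

    atoms-⋀ : ∀ is → (∀ {i} → i ∈ is → atoms (f i) ⊆ X) → atoms (⋀ (map f is)) ⊆ X
    atoms-⋀ []       _ = atoms-¬ ⊥' λ ()
    atoms-⋀ (i ∷ is) h = atoms-∧ (f i) (⋀ (map f is)) (h (here refl)) (atoms-⋀ is (h ∘ there))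

    atoms-⋁ : ∀ is → (∀ {i} → i ∈ is → atoms (f i) ⊆ X) → atoms (⋁ (map f is)) ⊆ X
    atoms-⋁ []       _ = λ ()
    atoms-⋁ (i ∷ is) h = atoms-⇒ (¬' (f i)) (⋁ (map f is)) (atoms-¬ (f i) (h (here refl))) (atoms-⋁ is (h ∘ there))

-- Propositional completeness

infix 3 _⊢_
data _⊢_ (Γ : List Fm) : Fm → Set where
  hyp : ∀ {φ} → φ ∈ Γ → Γ ⊢ φ
  thm : ∀ {φ} → ⊢Rd φ → Γ ⊢ φ
  mp  : ∀ {φ ψ} → Γ ⊢ φ ⇒ ψ → Γ ⊢ φ → Γ ⊢ ψ

⊢Rd-id : ∀ φ → ⊢Rd (φ ⇒ φ)
⊢Rd-id φ = mp (mp (axS φ (φ ⇒ φ) φ) (axK φ (φ ⇒ φ))) (axK φ φ)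

deduction : ∀ {Γ φ ψ} → φ ∷ Γ ⊢ ψ → Γ ⊢ φ ⇒ ψ
deduction {φ = φ} (hyp (here refl)) = thm (⊢Rd-id φ)
deduction {φ = φ} (hyp (there m))   = mp (thm (axK _ φ)) (hyp m)
deduction {φ = φ} (thm d)           = mp (thm (axK _ φ)) (thm d)
deduction {φ = φ} (mp d e)          = mp (mp (thm (axS φ _ _)) (deduction d)) (deduction e)

weaken : ∀ {Γ Δ φ} → Γ ⊆ Δ → Γ ⊢ φ → Δ ⊢ φ
weaken Γ⊆Δ (hyp m)  = hyp (Γ⊆Δ m)
weaken Γ⊆Δ (thm d)  = thm d
weaken Γ⊆Δ (mp d e) = mp (weaken Γ⊆Δ d) (weaken Γ⊆Δ e)

closed : ∀ {φ} → [] ⊢ φ → ⊢Rd φ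
closed (thm d)  = d
closed (mp d e) = mp (closed d) (closed e)

explosion : ∀ {Γ} φ → Γ ⊢ ⊥' → Γ ⊢ φ
explosion φ d = mp (thm (axDN φ)) (mp (thm (axK ⊥' (¬' φ))) d)

by-cases : ∀ {Γ ψ} φ → φ ∷ Γ ⊢ ψ → ¬' φ ∷ Γ ⊢ ψ → Γ ⊢ ψ
by-cases {Γ} {ψ} φ ⊢ψ₁ ⊢ψ₂ =
  mp (thm (axDN ψ)) (deduction (mp (hyp (here refl)) (mp (weaken (xs⊆x∷xs _ _) (deduction ⊢ψ₂)) ⊢¬φ)))
  where
  ⊢¬φ : ¬' ψ ∷ Γ ⊢ ¬' φ
  ⊢¬φ = deduction (mp (hyp (there (here refl)))
                      (mp (weaken (xs⊆x∷xs _ _ ∘ xs⊆x∷xs _ _) (deduction ⊢ψ₁)) (hyp (here refl))))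

signed : Bool → Fm → Fm
signed true  a = a
signed false a = ¬' a

literal : (Fm → Bool) → Fm → Fm
literal t a = signed (t a) a

literals : List Fm → (Fm → Bool) → List Fm
literals X t = map (literal t) X

⊨ᵇ-signed : ∀ {r} b x → ev r x ≡ b → r ⊨ᵇ signed b x
⊨ᵇ-signed true  x e = subst T (sym e) tt
⊨ᵇ-signed false x e = subst (λ v → T (not v ∨ false)) (sym e) tt

signed-⊨ᵇ : ∀ {r} b x → r ⊨ᵇ signed b x → ev r x ≡ b
signed-⊨ᵇ {r} true x h = Equivalence.to T-≡ h
signed-⊨ᵇ {r} false x h with ev r x
... | false = refl
... | true  = ⊥-elim h

atoms-signed : ∀ {X} b x → atoms x ⊆ X → atoms (signed b x) ⊆ X
atoms-signed true  x sx = sx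
atoms-signed false x sx = atoms-¬ x sx

literals-agree : ∀ X {s t} → Agree X s t → literals X s ≡ literals X t
literals-agree []      _     = refl
literals-agree (x ∷ X) agree =
  cong₂ _∷_ (cong (λ b → signed b x) (agree (here refl))) (literals-agree X (agree ∘ there))

¬T⇒≡false : ∀ {b} → ¬ T b → b ≡ false
¬T⇒≡false {false} _  = refl
¬T⇒≡false {true}  ¬t = contradiction tt ¬t

signed-⇒ : ∀ {Γ} a b x y → Γ ⊢ signed x a → Γ ⊢ signed y b → Γ ⊢ signed (not x ∨ y) (a ⇒ b)
signed-⇒ a b true  true  _  ⊢b  = mp (thm (axK b a)) ⊢b
signed-⇒ a b true  false ⊢a ⊢¬b =
  deduction (mp (weaken (xs⊆x∷xs _ _) ⊢¬b) (mp (hyp (here refl)) (weaken (xs⊆x∷xs _ _) ⊢a)))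
signed-⇒ a b false _     ⊢¬a _  = deduction (explosion b (mp (weaken (xs⊆x∷xs _ _) ⊢¬a) (hyp (here refl))))

kalmar : ∀ {X} t ψ → atoms ψ ⊆ X → literals X t ⊢ signed (ev t ψ) ψ
kalmar t (var p) sub = hyp (∈-map⁺ (literal t) (sub (here refl)))
kalmar t ⊥'      sub = thm (⊢Rd-id ⊥')
kalmar t (a ⇒ b) sub =
  signed-⇒ a b (ev t a) (ev t b) (kalmar t a (sub ∘ xs⊆xs++ys _ _)) (kalmar t b (sub ∘ xs⊆ys++xs _ _))
kalmar t (a ▷ b) sub = hyp (∈-map⁺ (literal t) (sub (here refl)))

update : (Fm → Bool) → Fm → Bool → Fm → Bool
update t a b x with x ≟ᶠ a
... | yes _ = b
... | no  _ = t x

literal-update : ∀ {a X} t b {x} → x ∈ a ∷ X → literal (update t a b) x ∈ signed b a ∷ literals X t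
literal-update {a} t b {x} x∈a∷X with x ≟ᶠ a | x∈a∷X
... | yes refl | _         = here refl
... | no x≢a   | here x≡a  = contradiction x≡a x≢a
... | no _     | there x∈X = there (∈-map⁺ (literal t) x∈X)

literals-update : ∀ {a X} t b → literals (a ∷ X) (update t a b) ⊆ signed b a ∷ literals X t
literals-update t b (here refl) = literal-update t b (here refl)
literals-update {a} t b (there m) with ∈-map⁻ (literal (update t a b)) m
... | _ , x∈X , refl = literal-update t b (there x∈X)

eliminate : ∀ X {Γ ψ} → (∀ t → literals X t ++ Γ ⊢ ψ) → Γ ⊢ ψ
eliminate []      h = h (λ _ → true)
eliminate (a ∷ X) {Γ} h = eliminate X λ t →
  by-cases a (weaken (++⁺ˡ Γ (literals-update t true))  (h (update t a true)))
             (weaken (++⁺ˡ Γ (literals-update t false)) (h (update t a false)))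

Consistent : List Fm → (Fm → Bool) → Set
Consistent X t = ¬ (literals X t ⊢ ⊥')

consistent-agree : ∀ {X s t} → Agree X s t → Consistent X s → Consistent X t
consistent-agree {X} agree s-cons = s-cons ∘ subst (_⊢ ⊥') (sym (literals-agree X agree))

module _ (lem : ExcludedMiddle 0ℓ) where

  complete : ∀ X ψ → atoms ψ ⊆ X → (∀ t → Consistent X t → t ⊨ᵇ ψ) → ⊢Rd ψ
  complete X ψ sub valid = closed (eliminate X λ t → weaken (xs⊆xs++ys _ []) (derive t))
    where
    derive : ∀ t → literals X t ⊢ ψ
    derive t with lem {literals X t ⊢ ⊥'}
    ... | yes inconsistent = explosion ψ inconsistent
    ... | no consistent =
      subst (λ b → literals X t ⊢ signed b ψ) (Equivalence.to T-≡ (valid t consistent)) (kalmar t ψ sub)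

  complete-⇒ : ∀ X a b → atoms a ⊆ X → atoms b ⊆ X →
               (∀ t → Consistent X t → t ⊨ᵇ a → t ⊨ᵇ b) → ⊢Rd (a ⇒ b)
  complete-⇒ X a b sa sb valid = complete X (a ⇒ b) (atoms-⇒ a b sa sb) λ t c → ⊨ᵇ-⇒⁺ a b (valid t c)

▷-monoˡ : ∀ {Γ γ γ′ β} → ⊢Rd (γ′ ⇒ γ) → Γ ⊢ γ ▷ β → Γ ⊢ γ′ ▷ β
▷-monoˡ {β = β} d e = mp (thm (ruleM d (⊢Rd-id β))) e

▷-monoʳ : ∀ {Γ γ β β′} → ⊢Rd (β ⇒ β′) → Γ ⊢ γ ▷ β → Γ ⊢ γ ▷ β′
▷-monoʳ {γ = γ} d e = mp (thm (ruleM (⊢Rd-id γ) d)) e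

module _ {Γ : List Fm} {I : Set} (f : I → Fm) where

  ▷-⋁ : ∀ {β} is → (∀ {i} → i ∈ is → Γ ⊢ f i ▷ β) → Γ ⊢ ⋁ (map f is) ▷ β
  ▷-⋁ {β} []       _ = thm (axA2 β)
  ▷-⋁ {β} (i ∷ is) h = mp (mp (thm (axA1 (f i) β _)) (h (here refl))) (▷-⋁ is (h ∘ there))

  ▷-⋀ : ∀ {γ} is → (∀ {i} → i ∈ is → Γ ⊢ γ ▷ f i) → Γ ⊢ γ ▷ ⋀ (map f is)
  ▷-⋀ {γ} []       _ = thm (axA3 γ)
  ▷-⋀ {γ} (i ∷ is) h = mp (mp (thm (axA4 γ (f i) _)) (h (here refl))) (▷-⋀ is (h ∘ there))
-- Frames and soundness

record Frame : Set₁ where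
  field
    World : Set
    Step  : World → World → World → Set
    Val   : World → ℕ → Set

open Frame

Forces : (F : Frame) → World F → Fm → Set
Forces F w (var p) = Val F w p
Forces F w ⊥'      = ⊥
Forces F w (φ ⇒ ψ) = ¬ Forces F w φ ⊎ Forces F w ψ
Forces F w (φ ▷ ψ) = ∀ u → Forces F u φ → (∃ λ v → Step F w u v) → ∃ λ v → Step F w u v × Forces F v ψ

infix 4 Forces
syntax Forces F w φ = w ⊫[ F ] φ

IsDeterministic : Frame → Set
IsDeterministic F = ∀ {w u v v′} → Step F w u v → Step F w u v′ → v ≡ v′

module _ {F : Frame} where

  ⊫-⇒⁻ : ∀ {w} φ ψ → w ⊫[ F ] φ ⇒ ψ → w ⊫[ F ] φ → w ⊫[ F ] ψ
  ⊫-⇒⁻ φ ψ (inj₁ w⊮φ) w⊫φ = contradiction w⊫φ w⊮φ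
  ⊫-⇒⁻ φ ψ (inj₂ w⊫ψ) _   = w⊫ψ

  ⊫-∧⁺ : ∀ {w} φ ψ → w ⊫[ F ] φ → w ⊫[ F ] ψ → w ⊫[ F ] φ ∧' ψ
  ⊫-∧⁺ φ ψ w⊫φ w⊫ψ = inj₁ λ w⊫φ⇒¬ψ → ⊫-⇒⁻ ψ ⊥' (⊫-⇒⁻ φ (¬' ψ) w⊫φ⇒¬ψ w⊫φ) w⊫ψ

  module _ (lem : ExcludedMiddle 0ℓ) where

    ⊫-⇒⁺ : ∀ {w} φ ψ → (w ⊫[ F ] φ → w ⊫[ F ] ψ) → w ⊫[ F ] φ ⇒ ψ
    ⊫-⇒⁺ {w} φ ψ f with lem {w ⊫[ F ] φ}
    ... | yes w⊫φ = inj₂ (f w⊫φ)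
    ... | no  w⊮φ = inj₁ w⊮φ

    ⊫-¬¬⁻ : ∀ {w} φ → w ⊫[ F ] ¬' (¬' φ) → w ⊫[ F ] φ
    ⊫-¬¬⁻ {w} φ w⊫¬¬φ with lem {w ⊫[ F ] φ}
    ... | yes w⊫φ = w⊫φ
    ... | no  w⊮φ = ⊥-elim (⊫-⇒⁻ (¬' φ) ⊥' w⊫¬¬φ (inj₁ w⊮φ))

    ⊫-∨⁻ : ∀ {w} φ ψ → w ⊫[ F ] φ ∨' ψ → w ⊫[ F ] φ ⊎ w ⊫[ F ] ψ
    ⊫-∨⁻ {w} φ ψ w⊫φ∨ψ with lem {w ⊫[ F ] φ}
    ... | yes w⊫φ = inj₁ w⊫φ
    ... | no  w⊮φ = inj₂ (⊫-⇒⁻ (¬' φ) ψ w⊫φ∨ψ (inj₁ w⊮φ))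

    soundness : IsDeterministic F → ∀ {φ} → ⊢Rd φ → ∀ w → w ⊫[ F ] φ
    soundness det (axK φ ψ) w = ⊫-⇒⁺ φ (ψ ⇒ φ) λ w⊫φ → ⊫-⇒⁺ ψ φ λ _ → w⊫φ
    soundness det (axS φ ψ χ) w =
      ⊫-⇒⁺ (φ ⇒ ψ ⇒ χ) ((φ ⇒ ψ) ⇒ φ ⇒ χ) λ f → ⊫-⇒⁺ (φ ⇒ ψ) (φ ⇒ χ) λ g → ⊫-⇒⁺ φ χ λ w⊫φ →
        ⊫-⇒⁻ ψ χ (⊫-⇒⁻ φ (ψ ⇒ χ) f w⊫φ) (⊫-⇒⁻ φ ψ g w⊫φ)
    soundness det (axDN φ) w = ⊫-⇒⁺ (¬' (¬' φ)) φ (⊫-¬¬⁻ φ)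
    soundness det (axA1 φ ψ χ) w =
      ⊫-⇒⁺ (φ ▷ ψ) (χ ▷ ψ ⇒ (φ ∨' χ) ▷ ψ) λ h₁ → ⊫-⇒⁺ (χ ▷ ψ) ((φ ∨' χ) ▷ ψ) λ h₂ u u⊫φ∨χ step →
        Sum.[ (λ u⊫φ → h₁ u u⊫φ step) , (λ u⊫χ → h₂ u u⊫χ step) ] (⊫-∨⁻ φ χ u⊫φ∨χ)
    soundness det (axA2 φ) w = λ _ ()
    soundness det (axA3 φ) w = λ _ _ (v , step) → v , step , inj₁ λ ()
    soundness det (axA4 φ ψ χ) w =
      ⊫-⇒⁺ (φ ▷ ψ) (φ ▷ χ ⇒ φ ▷ (ψ ∧' χ)) λ h₁ → ⊫-⇒⁺ (φ ▷ χ) (φ ▷ (ψ ∧' χ)) λ h₂ u u⊫φ step →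
        let v₁ , step₁ , v₁⊫ψ = h₁ u u⊫φ step
            v₂ , step₂ , v₂⊫χ = h₂ u u⊫φ step
        in v₁ , step₁ , ⊫-∧⁺ ψ χ v₁⊫ψ (subst (λ v → v ⊫[ F ] χ) (det step₂ step₁) v₂⊫χ)
    soundness det (mp {φ} {ψ} d e) w = ⊫-⇒⁻ φ ψ (soundness det d w) (soundness det e w)
    soundness det (ruleM {φ₁} {φ₂} {ψ₁} {ψ₂} d e) w =
      ⊫-⇒⁺ (φ₂ ▷ ψ₁) (φ₁ ▷ ψ₂) λ h u u⊫φ₁ step →
        let v , step′ , v⊫ψ₁ = h u (⊫-⇒⁻ φ₁ φ₂ (soundness det d u) u⊫φ₁) step
        in v , step′ , ⊫-⇒⁻ ψ₁ ψ₂ (soundness det e v) v⊫ψ₁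

kripkeFrame : KModel → Frame
kripkeFrame M = record { World = Fin size ; Step = R ; Val = V }
  where open KModel M

module _ (M : KModel) where

  mutual
    ⊩⇒⊫ : ∀ {w} φ → _⊩_ M w φ → w ⊫[ kripkeFrame M ] φ
    ⊩⇒⊫ (var p) w⊩p          = w⊩p
    ⊩⇒⊫ (φ ⇒ ψ) (inj₁ w⊮φ)   = inj₁ (w⊮φ ∘ ⊫⇒⊩ φ)
    ⊩⇒⊫ (φ ⇒ ψ) (inj₂ w⊩ψ)   = inj₂ (⊩⇒⊫ ψ w⊩ψ)
    ⊩⇒⊫ (φ ▷ ψ) h u u⊫φ (v , r) =
      let v′ , r′ , v′⊩ψ = h u v r (⊫⇒⊩ φ u⊫φ) in v′ , r′ , ⊩⇒⊫ ψ v′⊩ψ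

    ⊫⇒⊩ : ∀ {w} φ → w ⊫[ kripkeFrame M ] φ → _⊩_ M w φ
    ⊫⇒⊩ (var p) w⊫p          = w⊫p
    ⊫⇒⊩ (φ ⇒ ψ) (inj₁ w⊯φ)   = inj₁ (w⊯φ ∘ ⊩⇒⊫ φ)
    ⊫⇒⊩ (φ ⇒ ψ) (inj₂ w⊫ψ)   = inj₂ (⊫⇒⊩ ψ w⊫ψ)
    ⊫⇒⊩ (φ ▷ ψ) h u v r u⊩φ =
      let v′ , r′ , v′⊫ψ = h u (⊩⇒⊫ φ u⊩φ) (v , r) in v′ , r′ , ⊫⇒⊩ ψ v′⊫ψ

arithmeticFrame : (ℕ → PFun) → Valuation → Frame
arithmeticFrame ξ ρ = record { World = ℕ ; Step = ξ ; Val = λ w p → ρ p w }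

module _ (ξ : ℕ → PFun) (ρ : Valuation) where

  mutual
    ∈⟦⟧⇒⊫ : ∀ {w} φ → w ∈⟦ φ ⟧ ξ / ρ → w ⊫[ arithmeticFrame ξ ρ ] φ
    ∈⟦⟧⇒⊫ (var p) w∈p        = w∈p
    ∈⟦⟧⇒⊫ (φ ⇒ ψ) (inj₁ w∉φ) = inj₁ (w∉φ ∘ ⊫⇒∈⟦⟧ φ)
    ∈⟦⟧⇒⊫ (φ ⇒ ψ) (inj₂ w∈ψ) = inj₂ (∈⟦⟧⇒⊫ ψ w∈ψ)
    ∈⟦⟧⇒⊫ (φ ▷ ψ) h u u⊫φ ξwu↓ =
      let v , ξwuv , v∈ψ = h u (⊫⇒∈⟦⟧ φ u⊫φ) ξwu↓ in v , ξwuv , ∈⟦⟧⇒⊫ ψ v∈ψ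

    ⊫⇒∈⟦⟧ : ∀ {w} φ → w ⊫[ arithmeticFrame ξ ρ ] φ → w ∈⟦ φ ⟧ ξ / ρ
    ⊫⇒∈⟦⟧ (var p) w⊫p        = w⊫p
    ⊫⇒∈⟦⟧ (φ ⇒ ψ) (inj₁ w⊯φ) = inj₁ (w⊯φ ∘ ∈⟦⟧⇒⊫ φ)
    ⊫⇒∈⟦⟧ (φ ⇒ ψ) (inj₂ w⊫ψ) = inj₂ (⊫⇒∈⟦⟧ ψ w⊫ψ)
    ⊫⇒∈⟦⟧ (φ ▷ ψ) h u u∈φ ξwu↓ =
      let v , ξwuv , v⊫ψ = h u (∈⟦⟧⇒⊫ φ u∈φ) ξwu↓ in v , ξwuv , ⊫⇒∈⟦⟧ ψ v⊫ψ

mutual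
  eval-functional : ∀ {k} {c : Code k} {xs y y′} → Eval c xs y → Eval c xs y′ → y ≡ y′
  eval-functional ev-zer ev-zer = refl
  eval-functional ev-sc ev-sc = refl
  eval-functional ev-proj ev-proj = refl
  eval-functional (ev-comp gs f) (ev-comp gs′ f′) with evalAll-functional gs gs′
  ... | refl = eval-functional f f′
  eval-functional (ev-prec0 d) (ev-prec0 d′) = eval-functional d d′
  eval-functional (ev-precS d e) (ev-precS d′ e′) with eval-functional d d′
  ... | refl = eval-functional e e′
  eval-functional (ev-mu {n = n} d below) (ev-mu {n = n′} d′ below′) with <-cmp n n′
  ... | tri≈ _ n≡n′ _ = n≡n′
  ... | tri< n<n′ _ _ = case eval-functional d (proj₂ (below′ n n<n′)) of λ ()
  ... | tri> _ _ n′<n = case eval-functional (proj₂ (below n′ n′<n)) d′ of λ ()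

  evalAll-functional : ∀ {k m} {gs : Vec (Code k) m} {xs ys ys′} →
                       EvalAll gs xs ys → EvalAll gs xs ys′ → ys ≡ ys′
  evalAll-functional []       []         = refl
  evalAll-functional (e ∷ es) (e′ ∷ es′) = cong₂ _∷_ (eval-functional e e′) (evalAll-functional es es′)

arithmeticFrame-deterministic : ∀ {ξ} ρ → Enumeration ξ → IsDeterministic (arithmeticFrame ξ ρ)
arithmeticFrame-deterministic {ξ} ρ E {w} {u} {v} {v′} ξwuv ξwuv′ =
  let c , ξw≈c = Enumeration.onlyRecursive E w
  in eval-functional (Equivalence.to (ξw≈c u v) ξwuv) (Equivalence.to (ξw≈c u v′) ξwuv′)

module _ {F G : Frame} (f : World F → World G)
  (forth : ∀ {w u v} → Step F w u v → Step G (f w) (f u) (f v))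
  (back  : ∀ {w u′ v′} → Step G (f w) u′ v′ → ∃₂ λ u v → Step F w u v × u′ ≡ f u × v′ ≡ f v)
  (val⁺  : ∀ {w p} → Val F w p → Val G (f w) p)
  (val⁻  : ∀ {w p} → Val G (f w) p → Val F w p)
  (G-det : IsDeterministic G)
  where

  mutual
    bounded-morphism⁺ : ∀ φ {w} → w ⊫[ F ] φ → f w ⊫[ G ] φ
    bounded-morphism⁺ (var p) w⊫p        = val⁺ w⊫p
    bounded-morphism⁺ (φ ⇒ ψ) (inj₁ w⊯φ) = inj₁ (w⊯φ ∘ bounded-morphism⁻ φ)
    bounded-morphism⁺ (φ ⇒ ψ) (inj₂ w⊫ψ) = inj₂ (bounded-morphism⁺ ψ w⊫ψ)
    bounded-morphism⁺ (φ ▷ ψ) h _ fu⊫φ (_ , step) with back step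
    ... | u , v , step′ , refl , refl =
      let v′ , step″ , v′⊫ψ = h u (bounded-morphism⁻ φ fu⊫φ) (v , step′)
      in f v′ , forth step″ , bounded-morphism⁺ ψ v′⊫ψ

    bounded-morphism⁻ : ∀ φ {w} → f w ⊫[ G ] φ → w ⊫[ F ] φ
    bounded-morphism⁻ (var p) fw⊫p        = val⁻ fw⊫p
    bounded-morphism⁻ (φ ⇒ ψ) (inj₁ fw⊯φ) = inj₁ (fw⊯φ ∘ bounded-morphism⁺ φ)
    bounded-morphism⁻ (φ ⇒ ψ) (inj₂ fw⊫ψ) = inj₂ (bounded-morphism⁻ ψ fw⊫ψ)
    bounded-morphism⁻ (φ ▷ ψ) h u u⊫φ (v , step) =
      let v′ , step′ , v′⊫ψ = h (f u) (bounded-morphism⁺ φ u⊫φ) (f v , forth step)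
      in v , step , bounded-morphism⁻ ψ (subst (λ x → x ⊫[ G ] ψ) (G-det step′ (forth step)) v′⊫ψ)

unravel : Frame → Frame
unravel F = record { World = ℕ × World F ; Step = step ; Val = λ (_ , w) → Val F w }
  where
  step : ℕ × World F → ℕ × World F → ℕ × World F → Set
  step (zero  , w) _       _       = ⊥
  step (suc k , w) (i , u) (j , v) = i ≡ k × j ≡ k × Step F w u v

module _ (F : Frame) where

  mutual
    unravel⁺ : ∀ φ {k w} → depth φ ≤ k → w ⊫[ F ] φ → (k , w) ⊫[ unravel F ] φ
    unravel⁺ (var p) _ w⊫p        = w⊫p
    unravel⁺ (φ ⇒ ψ) d (inj₁ w⊯φ) = inj₁ (w⊯φ ∘ unravel⁻ φ (≤-trans (m≤m⊔n _ _) d))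
    unravel⁺ (φ ⇒ ψ) d (inj₂ w⊫ψ) = inj₂ (unravel⁺ ψ (≤-trans (m≤n⊔m _ _) d) w⊫ψ)
    unravel⁺ (φ ▷ ψ) (s≤s d) h (_ , u) u⊫φ ((_ , v) , refl , refl , step) =
      let v′ , step′ , v′⊫ψ = h u (unravel⁻ φ (≤-trans (m≤m⊔n _ _) d) u⊫φ) (v , step)
      in (_ , v′) , (refl , refl , step′) , unravel⁺ ψ (≤-trans (m≤n⊔m _ _) d) v′⊫ψ

    unravel⁻ : ∀ φ {k w} → depth φ ≤ k → (k , w) ⊫[ unravel F ] φ → w ⊫[ F ] φ
    unravel⁻ (var p) _ w⊫p        = w⊫p
    unravel⁻ (φ ⇒ ψ) d (inj₁ w⊯φ) = inj₁ (w⊯φ ∘ unravel⁺ φ (≤-trans (m≤m⊔n _ _) d))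
    unravel⁻ (φ ⇒ ψ) d (inj₂ w⊫ψ) = inj₂ (unravel⁻ ψ (≤-trans (m≤n⊔m _ _) d) w⊫ψ)
    unravel⁻ (φ ▷ ψ) (s≤s d) h u u⊫φ (v , step) with h (_ , u) (unravel⁺ φ (≤-trans (m≤m⊔n _ _) d) u⊫φ) ((_ , v) , refl , refl , step)
    ... | (_ , v′) , (refl , refl , step′) , v′⊫ψ = v′ , step′ , unravel⁻ ψ (≤-trans (m≤n⊔m _ _) d) v′⊫ψ

-- The canonical model of a formula

module Canonical (lem : ExcludedMiddle 0ℓ) (φ : Fm) where

  open DecMembership _≟ᶠ_ using (_∈?_)

  A : List Fm
  A = closure φ

  n : ℕ
  n = length A

  atoms⊆A : ∀ {x} → x ∈ A → atoms x ⊆ A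
  atoms⊆A {x} x∈A = ⊆-trans (atoms⊆closure x) (∈-closure⇒⊆ φ x∈A)

  ▷-closed : ∀ {a b} → a ▷ b ∈ A → atoms a ⊆ A × atoms b ⊆ A
  ▷-closed {a} {b} ab∈A =
    ⊆-trans (atoms⊆closure a) (∈-closure⇒⊆ φ ab∈A ∘ there ∘ xs⊆xs++ys _ _) ,
    ⊆-trans (atoms⊆closure b) (∈-closure⇒⊆ φ ab∈A ∘ there ∘ xs⊆ys++xs (closure b) (closure a))

  χ : (Fm → Bool) → Fm
  χ t = ⋀ (literals A t)

  atoms-χ : ∀ t → atoms (χ t) ⊆ A
  atoms-χ t = atoms-⋀ (literal t) A λ {x} x∈A → atoms-signed (t x) x (atoms⊆A x∈A)

  ⊨ᵇ-χ : ∀ {r t} → Agree A r t → r ⊨ᵇ χ t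
  ⊨ᵇ-χ {r} {t} agree = ⊨ᵇ-⋀⁺ (literal t) A λ {x} x∈A →
    ⊨ᵇ-signed (t x) x (trans (closure-atom φ x∈A r) (agree x∈A))

  χ-agree : ∀ {r t} → r ⊨ᵇ χ t → Agree A r t
  χ-agree {r} {t} r⊨χ {x} x∈A =
    trans (sym (closure-atom φ x∈A r)) (signed-⊨ᵇ (t x) x (⊨ᵇ-⋀⁻ (literal t) A r⊨χ x∈A))

  State : Set
  State = Fin (2 ^ n)

  decode : State → Fm → Bool
  decode c x with x ∈? A
  ... | yes x∈A = Inverse.to 2↔Bool (finToFun c (Any.index x∈A))
  ... | no  _   = false

  encode : (Fm → Bool) → State
  encode t = funToFin λ i → Inverse.from 2↔Bool (t (lookup A i))

  decode-encode : ∀ t → Agree A (decode (encode t)) t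
  decode-encode t {x} x∈A with x ∈? A
  ... | no x∉A = contradiction x∈A x∉A
  ... | yes m  = begin
    to (finToFun (encode t) (Any.index m)) ≡⟨ cong to (finToFun-funToFin _ (Any.index m)) ⟩
    to (from (t (lookup A (Any.index m))))  ≡⟨ Inverse.strictlyInverseˡ 2↔Bool _ ⟩
    t (lookup A (Any.index m))              ≡⟨ cong t (lookup-index m) ⟨
    t x                                 ∎
    where
    open ≡-Reasoning
    open Inverse 2↔Bool using (to; from)

  record Witnessing (s : Fm → Bool) (α β : Fm) (Δ Δ′ : Fm → Bool) : Set where
    field
      consistentˡ : Consistent A Δ
      consistentʳ : Consistent A Δ′
      antecedent  : Δ ⊨ᵇ α
      consequent  : ¬ Δ′ ⊨ᵇ β
      transfer    : ∀ {a b} → a ▷ b ∈ A → T (s (a ▷ b)) → Δ ⊨ᵇ a → Δ′ ⊨ᵇ b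

  open Witnessing

  witnessing-agree : ∀ {s α β Δ₁ Δ₁′ Δ₂ Δ₂′} → α ▷ β ∈ A → Agree A Δ₁ Δ₂ → Agree A Δ₁′ Δ₂′ →
                     Witnessing s α β Δ₁ Δ₁′ → Witnessing s α β Δ₂ Δ₂′
  witnessing-agree {α = α} {β} αβ∈A agree agree′ W = record
    { consistentˡ = consistent-agree agree (consistentˡ W)
    ; consistentʳ = consistent-agree agree′ (consistentʳ W)
    ; antecedent  = ⊨ᵇ-agree α (proj₁ (▷-closed αβ∈A)) agree (antecedent W)
    ; consequent  = consequent W ∘ ⊨ᵇ-agree β (proj₂ (▷-closed αβ∈A)) (sym ∘ agree′)
    ; transfer    = λ {a} {b} ab∈A s⊨ab Δ₂⊨a →
        ⊨ᵇ-agree b (proj₂ (▷-closed ab∈A)) agree′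
          (transfer W ab∈A s⊨ab (⊨ᵇ-agree a (proj₁ (▷-closed ab∈A)) (sym ∘ agree) Δ₂⊨a))
    }

  -- Without witnesses, α ▷ β is derivable from the literals of s: split α into the
  -- cases χ t ∧ α by A1, and in each case gather by A4 the boxes of s it fires,
  -- whose conclusions then entail β.
  module _ {s α β} (αβ∈A : α ▷ β ∈ A) (no-witness : ¬ ∃₂ (Witnessing s α β)) where

    private
      Γ : List Fm
      Γ = literals A s

      atoms-α = proj₁ (▷-closed αβ∈A)
      atoms-β = proj₂ (▷-closed αβ∈A)

    fired : (Fm → Bool) → Fm → Fm
    fired t (a ▷ b) = if s (a ▷ b) ∧ ev t a then b else ⊤'
    fired t _       = ⊤'

    fired-▷ : ∀ t {a b} → T (s (a ▷ b)) → t ⊨ᵇ a → fired t (a ▷ b) ≡ b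
    fired-▷ t {a} {b} s⊨ab t⊨a with s (a ▷ b) | ev t a
    ... | true  | true  = refl
    ... | true  | false = ⊥-elim t⊨a
    ... | false | _     = ⊥-elim s⊨ab

    atoms-fired : ∀ t {x} → x ∈ A → atoms (fired t x) ⊆ A
    atoms-fired t {a ▷ b} ab∈A with s (a ▷ b) ∧ ev t a
    ... | true  = proj₂ (▷-closed ab∈A)
    ... | false = λ ()
    atoms-fired t {var _} _ = λ ()
    atoms-fired t {⊥'}    _ = λ ()
    atoms-fired t {_ ⇒ _} _ = λ ()

    fired-derivable : ∀ t {x} → x ∈ A → Γ ⊢ χ t ∧' α ▷ fired t x
    fired-derivable t {a ▷ b} ab∈A with s (a ▷ b) in s-ab | ev t a in t-a
    ... | true  | true  = ▷-monoˡ χ∧α⇒a (hyp ab∈Γ)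
      where
      ab∈Γ : a ▷ b ∈ Γ
      ab∈Γ = subst (λ v → signed v (a ▷ b) ∈ Γ) s-ab (∈-map⁺ (literal s) ab∈A)
      χ∧α⇒a : ⊢Rd (χ t ∧' α ⇒ a)
      χ∧α⇒a = complete-⇒ lem A (χ t ∧' α) a (atoms-∧ (χ t) α (atoms-χ t) atoms-α) (proj₁ (▷-closed ab∈A))
        λ r _ r⊨χ∧α → ⊨ᵇ-agree a (proj₁ (▷-closed ab∈A)) (sym ∘ χ-agree (proj₁ (⊨ᵇ-∧⁻ (χ t) α r⊨χ∧α)))
                                (subst T (sym t-a) tt)
    ... | true  | false = thm (axA3 _)
    ... | false | _     = thm (axA3 _)
    fired-derivable t {var _} _ = thm (axA3 _)
    fired-derivable t {⊥'}    _ = thm (axA3 _)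
    fired-derivable t {_ ⇒ _} _ = thm (axA3 _)

    -- If t is consistent and satisfies α, every consistent r satisfying all fired
    -- conclusions satisfies β: otherwise (t , r) would witness α ▷ β.
    fired⇒β : ∀ t → Consistent A t → t ⊨ᵇ α → ⊢Rd (⋀ (map (fired t) A) ⇒ β)
    fired⇒β t t-cons t⊨α =
      complete-⇒ lem A (⋀ (map (fired t) A)) β (atoms-⋀ (fired t) A (atoms-fired t)) atoms-β sat
      where
      sat : ∀ r → Consistent A r → r ⊨ᵇ ⋀ (map (fired t) A) → r ⊨ᵇ β
      sat r r-cons r⊨fired with T? (ev r β)
      ... | yes r⊨β = r⊨β
      ... | no  r⊭β = ⊥-elim (no-witness (t , r , record
        { consistentˡ = t-cons
        ; consistentʳ = r-cons
        ; antecedent  = t⊨α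
        ; consequent  = r⊭β
        ; transfer    = λ ab∈A s⊨ab t⊨a → subst (r ⊨ᵇ_) (fired-▷ t s⊨ab t⊨a) (⊨ᵇ-⋀⁻ (fired t) A r⊨fired ab∈A)
        }))

    case-derivable : ∀ t → Γ ⊢ χ t ∧' α ▷ β
    case-derivable t with lem {Consistent A t × t ⊨ᵇ α}
    ... | yes (t-cons , t⊨α) = ▷-monoʳ (fired⇒β t t-cons t⊨α) (▷-⋀ (fired t) A (fired-derivable t))
    ... | no ¬t-ok = ▷-monoˡ unsatisfiable (thm (axA2 β))
      where
      unsatisfiable : ⊢Rd (χ t ∧' α ⇒ ⊥')
      unsatisfiable = complete-⇒ lem A (χ t ∧' α) ⊥' (atoms-∧ (χ t) α (atoms-χ t) atoms-α) (λ ())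
        λ r r-cons r⊨χ∧α → let r⊨χ , r⊨α = ⊨ᵇ-∧⁻ (χ t) α r⊨χ∧α in
          ¬t-ok (consistent-agree (χ-agree r⊨χ) r-cons , ⊨ᵇ-agree α atoms-α (χ-agree r⊨χ) r⊨α)

    cases : Fm
    cases = ⋁ (map (λ c → χ (decode c) ∧' α) (allFin (2 ^ n)))

    α⇒cases : ⊢Rd (α ⇒ cases)
    α⇒cases = complete-⇒ lem A α cases atoms-α
      (atoms-⋁ _ (allFin _) λ {c} _ → atoms-∧ (χ (decode c)) α (atoms-χ (decode c)) atoms-α)
      λ r _ r⊨α → ⊨ᵇ-⋁⁺ (λ c → χ (decode c) ∧' α) (allFin _) (∈-allFin (encode r))
                     (⊨ᵇ-∧⁺ (χ _) α (⊨ᵇ-χ (sym ∘ decode-encode r)) r⊨α)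

    ▷-derivable : Γ ⊢ α ▷ β
    ▷-derivable = ▷-monoˡ α⇒cases (▷-⋁ (λ c → χ (decode c) ∧' α) (allFin _) λ {c} _ → case-derivable (decode c))

  witness : ∀ {s α β} → Consistent A s → α ▷ β ∈ A → ¬ s ⊨ᵇ α ▷ β → ∃₂ (Witnessing s α β)
  witness {s} {α} {β} s-cons αβ∈A s⊭αβ with lem {∃₂ (Witnessing s α β)}
  ... | yes w    = w
  ... | no  none = contradiction (mp (hyp ¬αβ∈Γ) (▷-derivable αβ∈A none)) s-cons
    where
    ¬αβ∈Γ : ¬' (α ▷ β) ∈ literals A s
    ¬αβ∈Γ = subst (λ v → signed v (α ▷ β) ∈ literals A s) (¬T⇒≡false s⊭αβ) (∈-map⁺ (literal s) αβ∈A)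

  -- A world is a state code with a tag: zero for roots, suc j for the witnesses
  -- created for the j-th formula of A. The tags make the model deterministic.
  size : ℕ
  size = 2 ^ n * suc n

  world : State → Fin (suc n) → Fin size
  world = combine

  state : Fin size → Fm → Bool
  state p = decode (proj₁ (remQuot {2 ^ n} (suc n) p))

  tag : Fin size → Fin (suc n)
  tag p = proj₂ (remQuot {2 ^ n} (suc n) p)

  state-world : ∀ c i → Agree A (state (world c i)) (decode c)
  state-world c i _ = cong (λ cj → decode (proj₁ cj) _) (remQuot-combine {2 ^ n} c i)

  Refutes : (Fm → Bool) → Fin n → Set
  Refutes s j = ∃₂ λ α β → lookup A j ≡ α ▷ β × Consistent A s × ¬ s ⊨ᵇ α ▷ β

  -- (p , p) is a junk value: it is never used, as R below requires Refutes.
  children : Fin size → Fin n → Fin size × Fin size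
  children p j with lem {Refutes (state p) j}
  ... | yes (α , β , e , s-cons , s⊭αβ) =
    let Δ , Δ′ , _ = witness s-cons (subst (_∈ A) e (∈-lookup j)) s⊭αβ
    in world (encode Δ) (suc j) , world (encode Δ′) (suc j)
  ... | no _ = p , p

  canonical : KModel
  canonical = record
    { size = size
    ; R    = λ p u v → ∃ λ j → Refutes (state p) j × u ≡ proj₁ (children p j) × v ≡ proj₂ (children p j)
    ; V    = λ p x → T (state p (var x))
    }

  children-tag : ∀ {p j} → Refutes (state p) j → tag (proj₁ (children p j)) ≡ suc j
  children-tag {p} {j} r with lem {Refutes (state p) j}
  ... | yes _  = cong proj₂ (remQuot-combine {2 ^ n} _ _)
  ... | no  ¬r = contradiction r ¬r

  children-witness : ∀ {p j α β} → lookup A j ≡ α ▷ β → Refutes (state p) j →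
    Witnessing (state p) α β (state (proj₁ (children p j))) (state (proj₂ (children p j)))
  children-witness {p} {j} e r with lem {Refutes (state p) j}
  ... | no ¬r = contradiction r ¬r
  ... | yes (α , β , e′ , s-cons , s⊭αβ) with ▷-injective (trans (sym e′) e)
  ...   | refl , refl =
    let αβ∈A = subst (_∈ A) e′ (∈-lookup j)
        Δ , Δ′ , W = witness s-cons αβ∈A s⊭αβ
    in witnessing-agree αβ∈A (normalise Δ) (normalise Δ′) W
    where
    normalise : ∀ t → Agree A t (state (world (encode t) (suc j)))
    normalise t x∈A = sym (trans (state-world _ _ x∈A) (decode-encode t x∈A))

  canonical-deterministic : Deterministic canonical
  canonical-deterministic p _ _ _ (j , r , refl , refl) (j′ , r′ , u≡u′ , refl)
    with suc-injective (trans (sym (children-tag r)) (trans (cong tag u≡u′) (children-tag r′)))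
  ... | refl = refl

  infix 4 _⊩ᶜ_
  _⊩ᶜ_ : Fin size → Fm → Set
  _⊩ᶜ_ = _⊩_ canonical

  mutual
    forced⇒sat : ∀ ψ {p} → closure ψ ⊆ A → Consistent A (state p) → p ⊩ᶜ ψ → state p ⊨ᵇ ψ
    forced⇒sat (var x) _ _ p⊩x = p⊩x
    forced⇒sat (a ⇒ b) sub p-cons (inj₁ p⊮a) =
      ⊨ᵇ-⇒⁺ a b λ p⊨a → contradiction (sat⇒forced a (sub ∘ xs⊆xs++ys _ _) p-cons p⊨a) p⊮a
    forced⇒sat (a ⇒ b) sub p-cons (inj₂ p⊩b) =
      ⊨ᵇ-⇒⁺ a b λ _ → forced⇒sat b (sub ∘ xs⊆ys++xs _ _) p-cons p⊩b
    forced⇒sat (a ▷ b) {p} sub p-cons p⊩ab with T? (state p (a ▷ b))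
    ... | yes p⊨ab = p⊨ab
    ... | no  p⊭ab = contradiction (forced⇒sat b (sub ∘ there ∘ xs⊆ys++xs _ _) (consistentʳ W) v⊩b) (consequent W)
      where
      m = sub (here refl)
      e = sym (lookup-index m)
      r : Refutes (state p) (Any.index m)
      r = a , b , e , p-cons , p⊭ab
      W = children-witness e r
      step = Any.index m , r , refl , refl
      v⊩b : proj₂ (children p (Any.index m)) ⊩ᶜ b
      v⊩b =
        let v′ , step′ , v′⊩b = p⊩ab _ _ step (sat⇒forced a (sub ∘ there ∘ xs⊆xs++ys _ _) (consistentˡ W) (antecedent W))
        in subst (_⊩ᶜ b) (canonical-deterministic _ _ _ _ step′ step) v′⊩b

    sat⇒forced : ∀ ψ {p} → closure ψ ⊆ A → Consistent A (state p) → state p ⊨ᵇ ψ → p ⊩ᶜ ψ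
    sat⇒forced (var x) _ _ p⊨x = p⊨x
    sat⇒forced (a ⇒ b) {p} sub p-cons p⊨a⇒b with T? (ev (state p) a)
    ... | yes p⊨a = inj₂ (sat⇒forced b (sub ∘ xs⊆ys++xs _ _) p-cons (⊨ᵇ-⇒⁻ a b p⊨a⇒b p⊨a))
    ... | no  p⊭a = inj₁ (p⊭a ∘ forced⇒sat a (sub ∘ xs⊆xs++ys _ _) p-cons)
    sat⇒forced (a ▷ b) {p} sub p-cons p⊨ab _ _ (j , r@(_ , _ , e , _) , refl , refl) u⊩a =
      _ , (j , r , refl , refl) ,
      sat⇒forced b (sub ∘ there ∘ xs⊆ys++xs _ _) (consistentʳ W)
        (transfer W (sub (here refl)) p⊨ab (forced⇒sat a (sub ∘ there ∘ xs⊆xs++ys _ _) (consistentˡ W) u⊩a))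
      where
      W = children-witness e r

  kripke-completeness : KValid φ → ⊢Rd φ
  kripke-completeness valid = complete lem A φ (atoms⊆closure φ) λ t t-cons →
    let root = world (encode t) zero
        agree : Agree A (state root) t
        agree x∈A = trans (state-world _ _ x∈A) (decode-encode t x∈A)
    in ⊨ᵇ-agree φ (atoms⊆closure φ) agree
         (forced⇒sat φ ⊆-refl (consistent-agree (sym ∘ agree) t-cons) (valid canonical canonical-deterministic root))

-- Codes of finite tables

κ : ∀ {k} → ℕ → Code k
κ zero    = zer
κ (suc m) = comp sc (κ m ∷ [])

eval-κ : ∀ {k} m {xs : Vec ℕ k} → Eval (κ m) xs m
eval-κ zero    = ev-zer
eval-κ (suc m) = ev-comp (eval-κ m ∷ []) ev-sc

predᶜ : Code 1
predᶜ = prec zer (proj 0F)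

eval-pred : ∀ x → Eval predᶜ (x ∷ []) (pred x)
eval-pred zero    = ev-prec0 ev-zer
eval-pred (suc x) = ev-precS (eval-pred x) ev-proj

-- (y , x) ↦ x ∸ y, by recursion on y
∸ᶜ : Code 2
∸ᶜ = prec (proj 0F) (comp predᶜ (proj 1F ∷ []))

eval-∸ : ∀ x y → Eval ∸ᶜ (y ∷ x ∷ []) (x ∸ y)
eval-∸ x zero    = ev-prec0 ev-proj
eval-∸ x (suc y) = subst (Eval ∸ᶜ _) (pred[m∸n]≡m∸[1+n] x y)
  (ev-precS (eval-∸ x y) (ev-comp (ev-proj ∷ []) (eval-pred (x ∸ y))))

ifZero : ℕ → ℕ → ℕ → ℕ
ifZero zero    y _ = y
ifZero (suc _) _ x = x

ifZeroᶜ : Code 3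
ifZeroᶜ = prec (proj 0F) (proj 3F)

eval-ifZero : ∀ b y x → Eval ifZeroᶜ (b ∷ y ∷ x ∷ []) (ifZero b y x)
eval-ifZero zero    y x = ev-prec0 ev-proj
eval-ifZero (suc b) y x = ev-precS (eval-ifZero b y x) ev-proj

ifEqual : ℕ → ℕ → ℕ → ℕ → ℕ
ifEqual zero    zero    v r = v
ifEqual zero    (suc _) v r = r
ifEqual (suc _) zero    v r = r
ifEqual (suc a) (suc b) v r = ifEqual a b v r

ifEqual-≡ : ∀ a {v r} → ifEqual a a v r ≡ v
ifEqual-≡ zero    = refl
ifEqual-≡ (suc a) = ifEqual-≡ a

ifEqual-≢ : ∀ {a b v r} → a ≢ b → ifEqual a b v r ≡ r
ifEqual-≢ {zero}  {zero}  a≢b = contradiction refl a≢b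
ifEqual-≢ {zero}  {suc _} _   = refl
ifEqual-≢ {suc _} {zero}  _   = refl
ifEqual-≢ {suc a} {suc b} a≢b = ifEqual-≢ (a≢b ∘ cong suc)

ifZero-∸ : ∀ a b v r → ifZero (a ∸ b) (ifZero (b ∸ a) v r) r ≡ ifEqual a b v r
ifZero-∸ zero    zero    v r = refl
ifZero-∸ zero    (suc b) v r = refl
ifZero-∸ (suc a) zero    v r = refl
ifZero-∸ (suc a) (suc b) v r = ifZero-∸ a b v r

ifEqualᶜ : Code 4
ifEqualᶜ = comp ifZeroᶜ
  ( comp ∸ᶜ (proj 1F ∷ proj 0F ∷ [])
  ∷ comp ifZeroᶜ (comp ∸ᶜ (proj 0F ∷ proj 1F ∷ []) ∷ proj 2F ∷ proj 3F ∷ [])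
  ∷ proj 3F
  ∷ [])

eval-ifEqual : ∀ a b v r → Eval ifEqualᶜ (a ∷ b ∷ v ∷ r ∷ []) (ifEqual a b v r)
eval-ifEqual a b v r = subst (Eval ifEqualᶜ _) (ifZero-∸ a b v r) (ev-comp
  ( ev-comp (ev-proj ∷ ev-proj ∷ []) (eval-∸ a b)
  ∷ ev-comp (ev-comp (ev-proj ∷ ev-proj ∷ []) (eval-∸ b a) ∷ ev-proj ∷ ev-proj ∷ []) (eval-ifZero _ v r)
  ∷ ev-proj
  ∷ [])
  (eval-ifZero _ _ r))

lookupTable : List (ℕ × ℕ) → ℕ → ℕ → ℕ
lookupTable []             d x = d
lookupTable ((k , v) ∷ ps) d x = ifEqual x k v (lookupTable ps d x)

tableᶜ : List (ℕ × ℕ) → ℕ → Code 1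
tableᶜ []             d = κ d
tableᶜ ((k , v) ∷ ps) d = comp ifEqualᶜ (proj 0F ∷ κ k ∷ κ v ∷ tableᶜ ps d ∷ [])

eval-table : ∀ ps d x → Eval (tableᶜ ps d) (x ∷ []) (lookupTable ps d x)
eval-table []             d x = eval-κ d
eval-table ((k , v) ∷ ps) d x =
  ev-comp (ev-proj ∷ eval-κ k ∷ eval-κ v ∷ eval-table ps d x ∷ []) (eval-ifEqual x k v _)

lookupTable-∈ : ∀ {ps x y} d → (x , y) ∈ ps → (∀ {y′} → (x , y′) ∈ ps → y′ ≡ y) → lookupTable ps d x ≡ y
lookupTable-∈ {_ ∷ ps} {x} d (here refl) _ = ifEqual-≡ x
lookupTable-∈ {(k , v) ∷ ps} {x} d (there m) unique with x ℕ.≟ k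
... | yes refl = trans (ifEqual-≡ x) (unique (here refl))
... | no  x≢k  = trans (ifEqual-≢ x≢k) (lookupTable-∈ d m (unique ∘ there))

lookupTable-∈⁻ : ∀ {ps d x y} → lookupTable ps d x ≡ y → (x , y) ∈ ps ⊎ y ≡ d
lookupTable-∈⁻ {[]}           refl = inj₂ refl
lookupTable-∈⁻ {(k , v) ∷ ps} {x = x} e with x ℕ.≟ k
... | yes refl = inj₁ (here (cong (x ,_) (trans (sym e) (ifEqual-≡ x))))
... | no  x≢k  = Sum.map₁ there (lookupTable-∈⁻ (trans (sym (ifEqual-≢ x≢k)) e))

shift : List (ℕ × ℕ) → List (ℕ × ℕ)
shift = map (map₂ suc)

graphBodyᶜ : List (ℕ × ℕ) → Code 2
graphBodyᶜ ps = comp ifEqualᶜ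
  (comp sc (proj 0F ∷ []) ∷ comp (tableᶜ (shift ps) 0) (proj 1F ∷ []) ∷ κ 0 ∷ κ 1 ∷ [])

eval-graphBody : ∀ ps z x →
  Eval (graphBodyᶜ ps) (z ∷ x ∷ []) (ifEqual (suc z) (lookupTable (shift ps) 0 x) 0 1)
eval-graphBody ps z x = ev-comp
  (ev-comp (ev-proj ∷ []) ev-sc ∷ ev-comp (ev-proj ∷ []) (eval-table (shift ps) 0 x) ∷ eval-κ 0 ∷ eval-κ 1 ∷ [])
  (eval-ifEqual _ _ 0 1)

-- μ z. [suc z = T x], where T is the table of ps with values shifted up by one and
-- default 0; this computes the partial function with graph ps when ps is functional.
graphᶜ : List (ℕ × ℕ) → Code 1
graphᶜ ps = mu (graphBodyᶜ ps)

graphᶜ-complete : ∀ {ps x y} → (x , y) ∈ ps → (∀ {y′} → (x , y′) ∈ ps → y′ ≡ y) → ⟦ graphᶜ ps ⟧₁ x y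
graphᶜ-complete {ps} {x} {y} m unique =
  ev-mu (subst (Eval _ _) hit (eval-graphBody ps y x))
        (λ z z<y → 0 , subst (Eval _ _) (miss z<y) (eval-graphBody ps z x))
  where
  unique′ : ∀ {y′} → (x , y′) ∈ shift ps → y′ ≡ suc y
  unique′ m′ with ∈-map⁻ (map₂ suc) m′
  ... | _ , m″ , refl = cong suc (unique m″)

  table-x : lookupTable (shift ps) 0 x ≡ suc y
  table-x = lookupTable-∈ 0 (∈-map⁺ (map₂ suc) m) unique′

  hit : ifEqual (suc y) (lookupTable (shift ps) 0 x) 0 1 ≡ 0
  hit rewrite table-x = ifEqual-≡ y

  miss : ∀ {z} → z < y → ifEqual (suc z) (lookupTable (shift ps) 0 x) 0 1 ≡ 1
  miss z<y rewrite table-x = ifEqual-≢ λ e → <-irrefl (ℕₚ.suc-injective e) z<y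

graphᶜ-sound : ∀ {ps x y} → ⟦ graphᶜ ps ⟧₁ x y → (x , y) ∈ ps
graphᶜ-sound {ps} {x} {y} (ev-mu d _)
  with suc y ℕ.≟ lookupTable (shift ps) 0 x
... | no  ≢ = case trans (eval-functional d (eval-graphBody ps y x)) (ifEqual-≢ ≢) of λ ()
... | yes e with lookupTable-∈⁻ (sym e)
...   | inj₂ ()
...   | inj₁ m with ∈-map⁻ (map₂ suc) m
...     | _ , m₀ , refl = m₀

-- Fresh indices

≈F-sym : ∀ {f g} → f ≈F g → g ≈F f
≈F-sym f≈g x y = ⇔.sym (f≈g x y)

≈F-trans : ∀ {f g h} → f ≈F g → g ≈F h → f ≈F h
≈F-trans f≈g g≈h x y = ⇔.trans (f≈g x y) (g≈h x y)

module Padding (lem : ExcludedMiddle 0ℓ) {ξ : ℕ → PFun} (E : Enumeration ξ) where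

  open Enumeration E

  differing-index : (c : Code 1) → ∃ λ d → ¬ ξ d ≈F ⟦ c ⟧₁
  differing-index c with lem {∃ λ y → ⟦ c ⟧₁ 0 y}
  ... | yes (y , c0↦y) =
    let d , ξd≈∅ = allRecursive (graphᶜ [])
    in d , λ ξd≈c → case graphᶜ-sound (Equivalence.to (ξd≈∅ 0 y) (Equivalence.from (ξd≈c 0 y) c0↦y)) of λ ()
  ... | no c0↑ =
    let d , ξd≈0 = allRecursive zer
    in d , λ ξd≈c → c0↑ (0 , Equivalence.to (ξd≈c 0 0) (Equivalence.from (ξd≈0 0 0) ev-zer))

  -- By the recursion theorem, some u satisfies ξ u ≈ ξ (f u), where f sends the indices
  -- below N of ⟦ c ⟧₁ to an index of a different function and everything else to an
  -- index of ⟦ c ⟧₁; such a u can only be an index of ⟦ c ⟧₁ that is at least N.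
  padding : (c : Code 1) (N : ℕ) → ∃ λ w → N ≤ w × ξ w ≈F ⟦ c ⟧₁
  padding c N = fixed-point (recursionThm 1 (λ _ → f) λ _ → f-recursive)
    where
    s₀ = proj₁ (allRecursive c)
    d  = proj₁ (differing-index c)

    index-of-c? : Decidable λ u → ξ u ≈F ⟦ c ⟧₁
    index-of-c? u = lem

    small : List ℕ
    small = filter index-of-c? (upTo N)

    table : List (ℕ × ℕ)
    table = map (_, d) small

    f : Vec ℕ 1 → ℕ
    f (u ∷ []) = lookupTable table s₀ u

    f-recursive : TotalRecursive f
    f-recursive = tableᶜ table s₀ , λ { (u ∷ []) → eval-table table s₀ u }

    fixed-point : (Σ (Vec ℕ 1) λ us → ∀ i → ξ (Vec.lookup us i) ≈F ξ (f us)) → ∃ λ w → N ≤ w × ξ w ≈F ⟦ c ⟧₁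
    fixed-point (u ∷ [] , ξu≈ξfu) with lem {u ∈ small}
    ... | yes u∈small = contradiction (≈F-trans (≈F-sym ξu≈ξd) ξu≈c) (proj₂ (differing-index c))
      where
      ξu≈c : ξ u ≈F ⟦ c ⟧₁
      ξu≈c = proj₂ (∈-filter⁻ index-of-c? {xs = upTo N} u∈small)

      only-d : ∀ {y} → (u , y) ∈ table → y ≡ d
      only-d m with ∈-map⁻ (_, d) m
      ... | _ , _ , refl = refl

      ξu≈ξd : ξ u ≈F ξ d
      ξu≈ξd = subst (λ v → ξ u ≈F ξ v) (lookupTable-∈ s₀ (∈-map⁺ (_, d) u∈small) only-d) (ξu≈ξfu 0F)
    ... | no u∉small = u , ≮⇒≥ (λ u<N → u∉small (∈-filter⁺ index-of-c? (∈-upTo⁺ u<N) ξu≈c)) , ξu≈c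
      where
      fu≡s₀ : lookupTable table s₀ u ≡ s₀
      fu≡s₀ with lookupTable-∈⁻ {table} {s₀} {u} refl
      ... | inj₂ e = e
      ... | inj₁ m with ∈-map⁻ (_, d) m
      ...   | _ , x∈small , e = contradiction (subst (_∈ small) (cong proj₁ (sym e)) x∈small) u∉small

      ξu≈c : ξ u ≈F ⟦ c ⟧₁
      ξu≈c = ≈F-trans (subst (λ v → ξ u ≈F ξ v) fu≡s₀ (ξu≈ξfu 0F)) (proj₂ (allRecursive c))

  record FreshBlock {m} (b : ℕ) (cs : Fin m → Code 1) : Set where
    field
      index     : Fin m → ℕ
      end       : ℕ
      b≤end     : b ≤ end
      bounds    : ∀ i → b ≤ index i × index i < end
      injective : ∀ i j → index i ≡ index j → i ≡ j
      computes  : ∀ i → ξ (index i) ≈F ⟦ cs i ⟧₁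

  freshBlock : ∀ {m} b (cs : Fin m → Code 1) → FreshBlock b cs
  freshBlock {zero} b cs = record
    { index = λ () ; end = b ; b≤end = ≤-refl ; bounds = λ () ; injective = λ () ; computes = λ () }
  freshBlock {suc m} b cs = record
    { index     = index′
    ; end       = suc w
    ; b≤end     = ≤-trans b≤end (≤-trans end≤w (n≤1+n w))
    ; bounds    = bounds′
    ; injective = injective′
    ; computes  = computes′
    }
    where
    rest = freshBlock b (cs ∘ suc)
    open FreshBlock rest

    w = proj₁ (padding (cs 0F) end)
    end≤w = proj₁ (proj₂ (padding (cs 0F) end))

    index′ : Fin (suc m) → ℕ
    index′ zero    = w
    index′ (suc i) = index i

    bounds′ : ∀ i → b ≤ index′ i × index′ i < suc w
    bounds′ zero    = ≤-trans b≤end end≤w , ≤-refl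
    bounds′ (suc i) = proj₁ (bounds i) , <-≤-trans (proj₂ (bounds i)) (≤-trans end≤w (n≤1+n w))

    index≢w : ∀ i → index i ≢ w
    index≢w i = <⇒≢ (<-≤-trans (proj₂ (bounds i)) end≤w)

    injective′ : ∀ i j → index′ i ≡ index′ j → i ≡ j
    injective′ zero    zero    _ = refl
    injective′ zero    (suc j) e = contradiction (sym e) (index≢w j)
    injective′ (suc i) zero    e = contradiction e (index≢w i)
    injective′ (suc i) (suc j) e = cong suc (injective i j e)

    computes′ : ∀ i → ξ (index′ i) ≈F ⟦ cs i ⟧₁
    computes′ zero    = proj₂ (proj₂ (padding (cs 0F) end))
    computes′ (suc i) = computes i

-- Embedding finite deterministic models into arithmetic

module Embedding (lem : ExcludedMiddle 0ℓ) {ξ} (E : Enumeration ξ) (M : KModel) (M-det : Deterministic M) where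

  open KModel M
  open Padding lem E

  adjacent? : ∀ w → Decidable (uncurry (R w))
  adjacent? w _ = lem

  edges : Fin size → List (Fin size × Fin size)
  edges w = filter (adjacent? w) (cartesianProduct (allFin size) (allFin size))

  edges⁺ : ∀ {w u v} → R w u v → (u , v) ∈ edges w
  edges⁺ r = ∈-filter⁺ (adjacent? _) (∈-cartesianProduct⁺ (∈-allFin _) (∈-allFin _)) r

  edges⁻ : ∀ {w u v} → (u , v) ∈ edges w → R w u v
  edges⁻ {w} m = proj₂ (∈-filter⁻ (adjacent? w) {xs = cartesianProduct (allFin size) (allFin size)} m)

  graphAt : (Fin size → ℕ) → Fin size → List (ℕ × ℕ)
  graphAt ix w = map (Product.map ix ix) (edges w)

  -- Level k + 1 realises the edges between the indices chosen for level k,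
  -- with fresh indices above all those of lower levels.
  start : ℕ → ℕ
  codes : ℕ → Fin size → Code 1
  level : ∀ k → FreshBlock (start k) (codes k)

  level k = freshBlock (start k) (codes k)

  start zero    = 0
  start (suc k) = FreshBlock.end (level k)

  codes zero    _ = graphᶜ []
  codes (suc k)   = graphᶜ ∘ graphAt (FreshBlock.index (level k))

  indexAt : ℕ → Fin size → ℕ
  indexAt k = FreshBlock.index (level k)

  index : ℕ × Fin size → ℕ
  index (k , w) = indexAt k w

  start-mono : ∀ {k k′} → k ≤′ k′ → start k ≤ start k′
  start-mono ≤′-refl                = ≤-refl
  start-mono (≤′-step {k′} k≤′k′) = ≤-trans (start-mono k≤′k′) (FreshBlock.b≤end (level k′))

  index-< : ∀ {k k′ w w′} → k < k′ → index (k , w) < index (k′ , w′)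
  index-< {k} {k′} {w} {w′} k<k′ = <-≤-trans (proj₂ (FreshBlock.bounds (level k) w))
    (≤-trans (start-mono (≤⇒≤′ k<k′)) (proj₁ (FreshBlock.bounds (level k′) w′)))

  index-injective : ∀ {x y} → index x ≡ index y → x ≡ y
  index-injective {k , w} {k′ , w′} e with <-cmp k k′
  ... | tri< k<k′ _ _ = contradiction e (<⇒≢ (index-< k<k′))
  ... | tri> _ _ k′<k = contradiction (sym e) (<⇒≢ (index-< k′<k))
  ... | tri≈ _ refl _ = cong (k ,_) (FreshBlock.injective (level k) w w′ e)

  graphAt-functional : ∀ {ix} → (∀ u u′ → ix u ≡ ix u′ → u ≡ u′) →
                       ∀ w {x y y′} → (x , y) ∈ graphAt ix w → (x , y′) ∈ graphAt ix w → y′ ≡ y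
  graphAt-functional {ix} ix-injective w m m′ with ∈-map⁻ (Product.map ix ix) m | ∈-map⁻ (Product.map ix ix) m′
  ... | (u , v) , uv∈ , refl | (u′ , v′) , uv′∈ , e with ix-injective u u′ (cong proj₁ e)
  ...   | refl = trans (cong proj₂ e) (cong ix (M-det w u v′ v (edges⁻ uv′∈) (edges⁻ uv∈)))

  computes : ∀ k w → ξ (index (k , w)) ≈F ⟦ codes k w ⟧₁
  computes k = FreshBlock.computes (level k)

  valuation : Valuation
  valuation p x = ∃ λ kw → index kw ≡ x × V (proj₂ kw) p

  forth : ∀ {a b c} → Step (unravel (kripkeFrame M)) a b c → ξ (index a) (index b) (index c)
  forth {zero  , _} ()
  forth {suc k , w} (refl , refl , r) =
    Equivalence.from (computes (suc k) w _ _)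
      (graphᶜ-complete uv∈ (graphAt-functional (FreshBlock.injective (level k)) w uv∈))
    where uv∈ = ∈-map⁺ (Product.map (indexAt k) (indexAt k)) (edges⁺ r)

  back : ∀ {a x y} → ξ (index a) x y → ∃₂ λ b c → Step (unravel (kripkeFrame M)) a b c × x ≡ index b × y ≡ index c
  back {zero , w} ξxy = case graphᶜ-sound (Equivalence.to (computes 0 w _ _) ξxy) of λ ()
  back {suc k , w} ξxy
    with ∈-map⁻ (Product.map (indexAt k) (indexAt k)) (graphᶜ-sound (Equivalence.to (computes (suc k) w _ _) ξxy))
  ... | (u , v) , uv∈ , refl = (k , u) , (k , v) , (refl , refl , edges⁻ uv∈) , refl , refl

  index-reflects : ∀ φ {a} → index a ∈⟦ φ ⟧ ξ / valuation → a ⊫[ unravel (kripkeFrame M) ] φ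
  index-reflects φ = bounded-morphism⁻ index forth back (λ {a} a⊨p → a , refl , a⊨p)
    (λ { {a} {p} (a′ , e , a′⊨p) → subst (λ b → V (proj₂ b) p) (index-injective {a′} {a} e) a′⊨p })
    (arithmeticFrame-deterministic valuation E) φ ∘ ∈⟦⟧⇒⊫ ξ valuation φ

kripke-soundness : ExcludedMiddle 0ℓ → ∀ {φ} → ⊢Rd φ → KValid φ
kripke-soundness lem {φ} ⊢φ M M-det w =
  ⊫⇒⊩ M φ (soundness {kripkeFrame M} lem (λ {w} {u} {v} {v′} → M-det w u v v′) ⊢φ w)

arithmetic-soundness : ExcludedMiddle 0ℓ → ∀ {φ ξ} → Enumeration ξ → ⊢Rd φ → ξ ⊨ φ
arithmetic-soundness lem {φ} {ξ} E ⊢φ ρ w =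
  ⊫⇒∈⟦⟧ ξ ρ φ (soundness {arithmeticFrame ξ ρ} lem (arithmeticFrame-deterministic ρ E) ⊢φ w)

arithmetic⇒kripke : ExcludedMiddle 0ℓ → ∀ {φ ξ} → Enumeration ξ → ξ ⊨ φ → KValid φ
arithmetic⇒kripke lem {φ} E valid M M-det w =
  ⊫⇒⊩ M φ (unravel⁻ (kripkeFrame M) φ ≤-refl (index-reflects φ (valid valuation (index (depth φ , w)))))
  where open Embedding lem E M M-det

theorem6 : ExcludedMiddle 0ℓ → (φ : Fm) → (ξ : ℕ → PFun) → Enumeration ξ →
    ((ξ ⊨ φ) ⇔ KValid φ) × (KValid φ ⇔ ⊢Rd φ)
theorem6 lem φ ξ E =
  mk⇔ (arithmetic⇒kripke lem {φ} E) (arithmetic-soundness lem {φ} E ∘ kripke-completeness) ,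
  mk⇔ kripke-completeness (kripke-soundness lem {φ})
  where open Canonical lem φ using (kripke-completeness)
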